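{- Let $E$ be a finite ground set, $k$ a positive integer, $\alpha\in(0,1)$, and $f:\mathbb{Z}_+^E\to\mathbb{R}_+$ a non-negative DR-submodular function. Let $\mathbf{o}$ be an optimal solution of $\max\{f(\mathbf{x}):\mathbf{x}\in\mathbb{Z}_+^E,\ \|\mathbf{x}\|_1\le k,\ \mathbf{0}\le\mathbf{x}\le k\cdot\mathbf{1}\}$, and define $\mathbf{o}_1\in\mathbb{Z}_+^E$ by $\mathbf{o}_1(e)=\mathbf{o}(e)$ if $\mathbf{o}(e)\le\alpha k$ and $\mathbf{o}_1(e)=0$ otherwise. Let $\mathbf{x},\mathbf{y}$ be the vectors obtained by the following procedure: start with $\mathbf{x}=\mathbf{y}=\mathbf{0}$; for each $e\in E$ in turn, let $d_{(\mathbf{x},e)}=\max\{d\in\mathbb{Z}: 0<d\le\alpha k,\ f(\mathbf{1}_e\mid\mathbf{x}+(d-1)\mathbf{1}_e)\ge f(\mathbf{x})/k\}$ and $d_{(\mathbf{y},e)}=\max\{d\in\mathbb{Z}: 0<d\le\alpha k,\ f(\mathbf{1}_e\mid\mathbf{y}+(d-1)\mathbf{1}_e)\ge f(\mathbf{y})/k\}$ (each taken to be $0$ if the set is empty); if $f(d_{(\mathbf{x},e)}\mathbf{1}_e\mid\mathbf{x})\ge f(d_{(\mathbf{y},e)}\mathbf{1}_e\mid\mathbf{y})$ set $\mathbf{x}\leftarrow\mathbf{x}+d_{(\mathbf{x},e)}\mathbf{1}_e$, otherwise set $\mathbf{y}\leftarrow\mathbf{y}+d_{(\mathbf{y},e)}\mathbf{1}_e$.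 Then $$f(\mathbf{o}_1\vee\mathbf{x})+f(\mathbf{o}_1\vee\mathbf{y})\le 4\big(f(\mathbf{x})+f(\mathbf{y})\big).$$
   Context: $\mathbf{1}_e$ is the $e$-th unit vector, $\mathbf{1}$ the all-ones vector, $\|\mathbf{x}\|_1=\sum_{e}\mathbf{x}(e)$, $f(\mathbf{a}\mid\mathbf{b}):=f(\mathbf{a}+\mathbf{b})-f(\mathbf{b})$, and $\vee$ denotes coordinatewise maximum. $\mathbf{x}\le\mathbf{y}$ means coordinatewise inequality. $f$ is DR-submodular if $f(\mathbf{x}+\mathbf{1}_e)-f(\mathbf{x})\ge f(\mathbf{y}+\mathbf{1}_e)-f(\mathbf{y})$ for all $\mathbf{x}\le\mathbf{y}$, $e\in E$; $f$ need not be monotone. -}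

module Defs where

open import Level using (Level; _⊔_) renaming (suc to lsuc)
open import Data.Nat as ℕ using (ℕ; zero; suc; _∸_)
open import Data.Fin using (Fin)
open import Data.Vec using (Vec; updateAt; zipWith; replicate; lookup; sum)
open import Data.List using (List; []; _∷_)
open import Data.Product using (Σ; ∃; ∃-syntax; _×_; _,_)
open import Data.Sum using (_⊎_)
open import Relation.Nullary using (¬_)
open import Relation.Binary using (IsTotalOrder)
open import Relation.Binary.PropositionalEquality using (_≡_)
open import Algebra.Bundles using (CommutativeRing)

-- An ordered field (standard axioms): a commutative ring with 1 ≠ 0 in which
-- every nonzero element has a multiplicative inverse, together with a total
-- order compatible with + and with multiplication of non-negatives.
-- ℝ is an instance; the paper's f : ℤ₊^E → ℝ₊ takes values in such a field.
record OrderedField (c ℓ₁ ℓ₂ : Level) : Set (lsuc (c ⊔ ℓ₁ ⊔ ℓ₂)) where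
  field
    commRing : CommutativeRing c ℓ₁
  open CommutativeRing commRing public
  field
    _≤_          : Carrier → Carrier → Set ℓ₂
    isTotalOrder : IsTotalOrder _≈_ _≤_
    1≉0          : ¬ (1# ≈ 0#)
    inverse      : ∀ x → ¬ (x ≈ 0#) → ∃[ y ] (x * y ≈ 1#)
    +-mono-≤     : ∀ {x y} z → x ≤ y → (x + z) ≤ (y + z)
    *-nonneg     : ∀ {x y} → 0# ≤ x → 0# ≤ y → 0# ≤ (x * y)

  _<_ : Carrier → Carrier → Set (ℓ₁ ⊔ ℓ₂)
  x < y = (x ≤ y) × ¬ (x ≈ y)

  ι : ℕ → Carrier
  ι zero    = 0#
  ι (suc n) = 1# + ι n

-- integer vectors ℤ₊^E with E = Fin n
Vecℕ : ℕ → Set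
Vecℕ n = Vec ℕ n

bump : ∀ {n} → Vecℕ n → Fin n → ℕ → Vecℕ n
bump x e d = updateAt x e (ℕ._+ d)

_∨_ : ∀ {n} → Vecℕ n → Vecℕ n → Vecℕ n
a ∨ b = zipWith ℕ._⊔_ a b

_≤ᵥ_ : ∀ {n} → Vecℕ n → Vecℕ n → Set
x ≤ᵥ y = ∀ i → lookup x i ℕ.≤ lookup y i

module Setup {c ℓ₁ ℓ₂} (F : OrderedField c ℓ₁ ℓ₂) where
  open OrderedField F

  _≥_ : Carrier → Carrier → Set ℓ₂
  a ≥ b = b ≤ a

  module _ {n : ℕ} (f : Vecℕ n → Carrier) (k : ℕ) (α : Carrier) where

    NonNeg : Set ℓ₂
    NonNeg = ∀ x → 0# ≤ f x

    DRSubmodular : Set ℓ₂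
    DRSubmodular = ∀ x y → x ≤ᵥ y → ∀ e →
      (f (bump x e 1) - f x) ≥ (f (bump y e 1) - f y)

    Feasible : Vecℕ n → Set
    Feasible x = (sum x ℕ.≤ k) × (∀ i → lookup x i ℕ.≤ k)

    Optimal : Vecℕ n → Set ℓ₂
    Optimal o = Feasible o × (∀ z → Feasible z → f z ≤ f o)

    ≤αk : ℕ → Set ℓ₂
    ≤αk d = ι d ≤ (α * ι k)

    IsO₁ : Vecℕ n → Vecℕ n → Set ℓ₂
    IsO₁ o o₁ = ∀ i → (≤αk (lookup o i) × lookup o₁ i ≡ lookup o i)
                   ⊎ (¬ ≤αk (lookup o i) × lookup o₁ i ≡ 0)

    -- f(1_e | x + (d-1)1_e) ≥ f(x)/k, written as k·f(1_e | x+(d-1)1_e) ≥ f(x) (k > 0)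
    Cond : Vecℕ n → Fin n → ℕ → Set ℓ₂
    Cond x e d = (ι k * (f (bump (bump x e (d ∸ 1)) e 1) - f (bump x e (d ∸ 1)))) ≥ f x

    IsD : Vecℕ n → Fin n → ℕ → Set ℓ₂
    IsD x e d =
        (d ≡ 0 × (∀ d′ → 0 ℕ.< d′ → ≤αk d′ → ¬ Cond x e d′))
      ⊎ (0 ℕ.< d × ≤αk d × Cond x e d × (∀ d′ → d ℕ.< d′ → ≤αk d′ → ¬ Cond x e d′))

    gain : Vecℕ n → Fin n → ℕ → Carrier
    gain x e d = f (bump x e d) - f x

    Step : Fin n → Vecℕ n × Vecℕ n → Vecℕ n × Vecℕ n → Set (ℓ₂)
    Step e (x , y) (x′ , y′) = Σ ℕ λ dx → Σ ℕ λ dy → IsD x e dx × IsD y e dy ×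
      ( (gain x e dx ≥ gain y e dy × x′ ≡ bump x e dx × y′ ≡ y)
      ⊎ (¬ (gain x e dx ≥ gain y e dy) × x′ ≡ x × y′ ≡ bump y e dy))

    Run : List (Fin n) → Vecℕ n × Vecℕ n → Vecℕ n × Vecℕ n → Set ℓ₂
    Run [] p q = Level.Lift ℓ₂ (p ≡ q)
    Run (e ∷ es) p q = Σ (Vecℕ n × Vecℕ n) λ r → Step e p r × Run es r q

{-# OPTIONS --safe #-}
module Submission where

open import Defs
open import Level using (Level)
open import Data.Nat as ℕ using (ℕ)
open import Data.Fin using (Fin)
open import Data.List using (allFin)
open import Data.Vec using (replicate)
open import Data.Product using (_×_; _,_)

open import Level using (lift)
open import Data.Nat using (zero; suc)
import Data.Nat.Properties as ℕₚ
import Data.Fin as Fin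
open import Data.Sum using (_⊎_; inj₁; inj₂)
open import Data.Product using (proj₁)
open import Data.Vec using ([]; _∷_; lookup; sum)
open import Data.Vec.Properties
  using ( updateAt-id-local; updateAt-updateAt-local; lookup∘updateAt; lookup∘updateAt′
        ; lookup-zipWith; lookup-replicate; zipWith-identityʳ; zipWith-comm )
open import Data.Vec.Relation.Binary.Pointwise.Extensional using (ext; Pointwise-≡⇒≡)
open import Data.List using (List; []; _∷_)
open import Data.List.Relation.Unary.All as All using (All; []; _∷_)
open import Data.List.Relation.Unary.AllPairs using ([]; _∷_)
open import Data.List.Relation.Unary.Any using (here; there)
open import Data.List.Relation.Unary.Unique.Propositional using (Unique)
open import Data.List.Relation.Unary.Unique.Propositional.Properties using (allFin⁺)
open import Data.List.Membership.Propositional using (_∈_)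
open import Data.List.Membership.Propositional.Properties using (∈-allFin)
open import Relation.Nullary using (¬_; contradiction; yes; no)
open import Relation.Binary using (IsTotalOrder; Poset)
open import Relation.Binary.PropositionalEquality as ≡ using (_≡_; _≢_; refl; cong; subst₂; ≢-sym)
import Relation.Binary.Reasoning.PartialOrder as PartialOrderReasoning
import Relation.Binary.Reasoning.Setoid as SetoidReasoning
import Algebra.Properties.CommutativeSemigroup as CommutativeSemigroupProperties

-- Follow one of the two vectors, say x, and add o₁ to it one element at a time, in the order in
-- which the algorithm visits E. By DR-submodularity, raising coordinate e to o₁(e) at the end gains
-- at most what the same increment gains at the moment e is visited. If x itself was then extended by
-- d = d_(x,e), every further unit up to o₁(e) ≤ αk fails the threshold test, so it gains less than
-- f(x)/k; if y was extended instead, the first d units gain at most what y gained, and the rest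
-- again less than f(x)/k each (f only increases along the run). Summing over E,
--   k (f(x ∨ o₁) − f(x)) ≤ ‖o₁‖₁ f(x) + k (f(y) − f(0)) ≤ k (f(x) + f(y)),
-- and adding the symmetric bound for y gives the inequality even with 3 in place of 4.

m⊔n≡m+[n∸m] : ∀ m n → m ℕ.⊔ n ≡ m ℕ.+ (n ℕ.∸ m)
m⊔n≡m+[n∸m] zero    n       = refl
m⊔n≡m+[n∸m] (suc m) zero    = cong suc (≡.sym (ℕₚ.+-identityʳ m))
m⊔n≡m+[n∸m] (suc m) (suc n) = cong suc (m⊔n≡m+[n∸m] m n)

m<n∸o⇒o+m<n : ∀ {m n o} → m ℕ.< n ℕ.∸ o → o ℕ.+ m ℕ.< n
m<n∸o⇒o+m<n {m} {n} {o} m<n∸o = begin-strict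
  o ℕ.+ m          <⟨ ℕₚ.+-monoʳ-< o m<n∸o ⟩
  o ℕ.+ (n ℕ.∸ o)  ≡⟨ ℕₚ.m+[n∸m]≡n (ℕₚ.<⇒≤ (ℕₚ.m∸n≢0⇒n<m {n} {o} (ℕₚ.m<n⇒n≢0 m<n∸o))) ⟩
  n                ∎
  where open ℕₚ.≤-Reasoning

module _ {n : ℕ} where

  bump-0 : (v : Vecℕ n) (e : Fin n) → bump v e 0 ≡ v
  bump-0 v e = updateAt-id-local e v (ℕₚ.+-identityʳ (lookup v e))

  bump-bump : (v : Vecℕ n) (e : Fin n) (a b : ℕ) → bump (bump v e a) e b ≡ bump v e (a ℕ.+ b)
  bump-bump v e a b = updateAt-updateAt-local e v (ℕₚ.+-assoc (lookup v e) a b)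

  bump-suc : (v : Vecℕ n) (e : Fin n) (j : ℕ) → bump (bump v e j) e 1 ≡ bump v e (suc j)
  bump-suc v e j = ≡.trans (bump-bump v e j 1) (cong (bump v e) (ℕₚ.+-comm j 1))

  lookup-bump : (v : Vecℕ n) (e : Fin n) (d : ℕ) → lookup (bump v e d) e ≡ lookup v e ℕ.+ d
  lookup-bump v e d = lookup∘updateAt e v

  lookup-bump-≢ : (v : Vecℕ n) {i e : Fin n} → i ≢ e → (d : ℕ) → lookup (bump v e d) i ≡ lookup v i
  lookup-bump-≢ v {i} {e} i≢e d = lookup∘updateAt′ i e i≢e v

  ≤ᵥ-trans : (u v w : Vecℕ n) → u ≤ᵥ v → v ≤ᵥ w → u ≤ᵥ w
  ≤ᵥ-trans _ _ _ u≤v v≤w i = ℕₚ.≤-trans (u≤v i) (v≤w i)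

  bump-mono : (u v : Vecℕ n) (e : Fin n) {a b : ℕ} → u ≤ᵥ v → a ℕ.≤ b → bump u e a ≤ᵥ bump v e b
  bump-mono u v e {a} {b} u≤v a≤b i with i Fin.≟ e
  ... | yes refl = subst₂ ℕ._≤_ (≡.sym (lookup-bump u e a)) (≡.sym (lookup-bump v e b))
                     (ℕₚ.+-mono-≤ (u≤v e) a≤b)
  ... | no i≢e   = subst₂ ℕ._≤_ (≡.sym (lookup-bump-≢ u i≢e a)) (≡.sym (lookup-bump-≢ v i≢e b)) (u≤v i)

  bump-monoʳ : (v : Vecℕ n) (e : Fin n) {a b : ℕ} → a ℕ.≤ b → bump v e a ≤ᵥ bump v e b
  bump-monoʳ v e = bump-mono v v e (λ _ → ℕₚ.≤-refl)

  ≤ᵥ-bump : (v : Vecℕ n) (e : Fin n) (d : ℕ) → v ≤ᵥ bump v e d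
  ≤ᵥ-bump v e d i = subst₂ ℕ._≤_ (cong (λ w → lookup w i) (bump-0 v e)) refl (bump-monoʳ v e ℕ.z≤n i)

  ≤ᵥ-∨ˡ : (u v : Vecℕ n) → u ≤ᵥ (u ∨ v)
  ≤ᵥ-∨ˡ u v i = subst₂ ℕ._≤_ refl (≡.sym (lookup-zipWith ℕ._⊔_ i u v)) (ℕₚ.m≤m⊔n (lookup u i) (lookup v i))

∨-bump : ∀ {n} (u w : Vecℕ n) (e : Fin n) (m : ℕ) → lookup w e ≡ 0 →
         (u ∨ bump w e m) ≡ bump (u ∨ w) e (m ℕ.∸ lookup u e)
∨-bump (a ∷ u) (_ ∷ w) Fin.zero    m refl   =
  cong (_∷ (u ∨ w)) (≡.trans (m⊔n≡m+[n∸m] a m) (cong (ℕ._+ (m ℕ.∸ a)) (≡.sym (ℕₚ.⊔-identityʳ a))))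
∨-bump (a ∷ u) (b ∷ w) (Fin.suc e) m w[e]≡0 = cong ((a ℕ.⊔ b) ∷_) (∨-bump u w e m w[e]≡0)

sum-bump : ∀ {n} (v : Vecℕ n) (e : Fin n) (d : ℕ) → sum (bump v e d) ≡ sum v ℕ.+ d
sum-bump (a ∷ v) Fin.zero    d =
  CommutativeSemigroupProperties.xy∙z≈xz∙y ℕₚ.+-commutativeSemigroup a d (sum v)
sum-bump (a ∷ v) (Fin.suc e) d = ≡.trans (cong (a ℕ.+_) (sum-bump v e d)) (≡.sym (ℕₚ.+-assoc a (sum v) d))

sum-mono-≤ᵥ : ∀ {n} (u v : Vecℕ n) → u ≤ᵥ v → sum u ℕ.≤ sum v
sum-mono-≤ᵥ []      []      _   = ℕ.z≤n
sum-mono-≤ᵥ (_ ∷ u) (_ ∷ v) u≤v = ℕₚ.+-mono-≤ (u≤v Fin.zero) (sum-mono-≤ᵥ u v (λ i → u≤v (Fin.suc i)))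

module _ {n : ℕ} where

  _↾_ : Vecℕ n → List (Fin n) → Vecℕ n
  v ↾ []       = replicate n 0
  v ↾ (e ∷ es) = bump (v ↾ es) e (lookup v e)

  lookup-↾-∉ : (v : Vecℕ n) {e : Fin n} (es : List (Fin n)) → All (e ≢_) es → lookup (v ↾ es) e ≡ 0
  lookup-↾-∉ v {e} []        []             = lookup-replicate e 0
  lookup-↾-∉ v     (e′ ∷ es) (e≢e′ ∷ e∉es) = ≡.trans (lookup-bump-≢ (v ↾ es) e≢e′ _) (lookup-↾-∉ v es e∉es)

  lookup-↾-∈ : (v : Vecℕ n) {i : Fin n} {es : List (Fin n)} → Unique es → i ∈ es →
               lookup (v ↾ es) i ≡ lookup v i
  lookup-↾-∈ v {es = e ∷ es} (e∉es ∷ _)      (here refl)  =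
    ≡.trans (lookup-bump (v ↾ es) e _) (cong (ℕ._+ lookup v e) (lookup-↾-∉ v es e∉es))
  lookup-↾-∈ v {es = e ∷ es} (e∉es ∷ unique) (there i∈es) =
    ≡.trans (lookup-bump-≢ (v ↾ es) (≢-sym (All.lookup e∉es i∈es)) _) (lookup-↾-∈ v unique i∈es)

  ↾-allFin : (v : Vecℕ n) → v ↾ allFin n ≡ v
  ↾-allFin v = Pointwise-≡⇒≡ (ext λ i → lookup-↾-∈ v (allFin⁺ n) (∈-allFin i))

module OrderedFieldProperties {c ℓ₁ ℓ₂} (F : OrderedField c ℓ₁ ℓ₂) where
  open OrderedField F hiding (+-mono-≤)
  open IsTotalOrder isTotalOrder public
    using (total; antisym) renaming (refl to ≤-refl; trans to ≤-trans; reflexive to ≤-reflexive)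
  open import Algebra.Properties.Ring ring using (-1*x≈-x; -‿involutive; x[y-z]≈xy-xz)
  open import Algebra.Properties.Group +-group using (//-rightDividesˡ)
  open import Algebra.Properties.CommutativeSemigroup +-commutativeSemigroup public using (interchange)

  poset : Poset c ℓ₁ ℓ₂
  poset = record { isPartialOrder = IsTotalOrder.isPartialOrder isTotalOrder }

  module ≤-Reasoning = PartialOrderReasoning poset

  ≰⇒≥ : ∀ {x y} → ¬ (x ≤ y) → y ≤ x
  ≰⇒≥ {x} {y} x≰y with total x y
  ... | inj₁ x≤y = contradiction x≤y x≰y
  ... | inj₂ y≤x = y≤x

  +-monoˡ-≤ : ∀ {x y} z → x ≤ y → (x + z) ≤ (y + z)
  +-monoˡ-≤ = OrderedField.+-mono-≤ F

  +-monoʳ-≤ : ∀ {x y} z → x ≤ y → (z + x) ≤ (z + y)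
  +-monoʳ-≤ {x} {y} z x≤y = begin
    z + x  ≈⟨ +-comm z x ⟩
    x + z  ≤⟨ +-monoˡ-≤ z x≤y ⟩
    y + z  ≈⟨ +-comm y z ⟩
    z + y  ∎
    where open ≤-Reasoning

  +-mono-≤ : ∀ {x y u v} → x ≤ y → u ≤ v → (x + u) ≤ (y + v)
  +-mono-≤ {y = y} {u} x≤y u≤v = ≤-trans (+-monoˡ-≤ u x≤y) (+-monoʳ-≤ y u≤v)

  x≤y⇒0≤y-x : ∀ {x y} → x ≤ y → 0# ≤ (y - x)
  x≤y⇒0≤y-x {x} {y} x≤y = begin
    0#     ≈⟨ -‿inverseʳ x ⟨
    x - x  ≤⟨ +-monoˡ-≤ (- x) x≤y ⟩
    y - x  ∎
    where open ≤-Reasoning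

  0≤y-x⇒x≤y : ∀ {x y} → 0# ≤ (y - x) → x ≤ y
  0≤y-x⇒x≤y {x} {y} 0≤y-x = begin
    x          ≈⟨ +-identityˡ x ⟨
    0# + x     ≤⟨ +-monoˡ-≤ x 0≤y-x ⟩
    y - x + x  ≈⟨ //-rightDividesˡ x y ⟩
    y          ∎
    where open ≤-Reasoning

  x-y≤z⇒x≤z+y : ∀ {x y z} → (x - y) ≤ z → x ≤ (z + y)
  x-y≤z⇒x≤z+y {x} {y} {z} x-y≤z = begin
    x          ≈⟨ //-rightDividesˡ y x ⟨
    x - y + y  ≤⟨ +-monoˡ-≤ y x-y≤z ⟩
    z + y      ∎
    where open ≤-Reasoning

  x≤x+y : ∀ {x y} → 0# ≤ y → x ≤ (x + y)
  x≤x+y {x} {y} 0≤y = begin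
    x       ≈⟨ +-identityʳ x ⟨
    x + 0#  ≤⟨ +-monoʳ-≤ x 0≤y ⟩
    x + y   ∎
    where open ≤-Reasoning

  x-y≤x : ∀ {x y} → 0# ≤ y → (x - y) ≤ x
  x-y≤x {x} {y} 0≤y = begin
    x - y         ≈⟨ +-identityˡ (x - y) ⟨
    0# + (x - y)  ≤⟨ +-monoˡ-≤ (x - y) 0≤y ⟩
    y + (x - y)   ≈⟨ trans (+-comm y (x - y)) (//-rightDividesˡ y x) ⟩
    x             ∎
    where open ≤-Reasoning

  x-y+[y-z]≈x-z : ∀ x y z → (x - y) + (y - z) ≈ x - z
  x-y+[y-z]≈x-z x y z = begin
    (x - y) + (y - z)    ≈⟨ +-assoc x (- y) (y - z) ⟩
    x + (- y + (y - z))  ≈⟨ +-congˡ (+-assoc (- y) y (- z)) ⟨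
    x + ((- y + y) - z)  ≈⟨ +-congˡ (+-congʳ (-‿inverseˡ y)) ⟩
    x + (0# - z)         ≈⟨ +-congˡ (+-identityˡ (- z)) ⟩
    x - z                ∎
    where open SetoidReasoning setoid

  *-monoˡ-≤ : ∀ {x y z} → 0# ≤ z → x ≤ y → (z * x) ≤ (z * y)
  *-monoˡ-≤ {x} {y} {z} 0≤z x≤y = 0≤y-x⇒x≤y (begin
    0#             ≤⟨ *-nonneg 0≤z (x≤y⇒0≤y-x x≤y) ⟩
    z * (y - x)    ≈⟨ x[y-z]≈xy-xz z y x ⟩
    z * y - z * x  ∎)
    where open ≤-Reasoning

  *-monoʳ-≤ : ∀ {x y z} → 0# ≤ z → x ≤ y → (x * z) ≤ (y * z)
  *-monoʳ-≤ {x} {y} {z} 0≤z x≤y = begin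
    x * z  ≈⟨ *-comm x z ⟩
    z * x  ≤⟨ *-monoˡ-≤ 0≤z x≤y ⟩
    z * y  ≈⟨ *-comm z y ⟩
    y * z  ∎
    where open ≤-Reasoning

  *-cancelˡ-≈ : ∀ {x y z} → ¬ z ≈ 0# → z * x ≈ z * y → x ≈ y
  *-cancelˡ-≈ {x} {y} {z} z≉0 zx≈zy with inverse z z≉0
  ... | w , zw≈1 = begin
    x            ≈⟨ *-identityˡ x ⟨
    1# * x       ≈⟨ *-congʳ (trans (sym zw≈1) (*-comm z w)) ⟩
    (w * z) * x  ≈⟨ *-assoc w z x ⟩
    w * (z * x)  ≈⟨ *-congˡ zx≈zy ⟩
    w * (z * y)  ≈⟨ *-assoc w z y ⟨
    (w * z) * y  ≈⟨ *-congʳ (trans (sym zw≈1) (*-comm z w)) ⟨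
    1# * y       ≈⟨ *-identityˡ y ⟩
    y            ∎
    where open SetoidReasoning setoid

  *-cancelˡ-≤ : ∀ {x y z} → 0# < z → (z * x) ≤ (z * y) → x ≤ y
  *-cancelˡ-≤ {x} {y} (0≤z , 0≉z) zx≤zy with total x y
  ... | inj₁ x≤y = x≤y
  ... | inj₂ y≤x = ≤-reflexive (*-cancelˡ-≈ (λ z≈0 → 0≉z (sym z≈0)) (antisym zx≤zy (*-monoˡ-≤ 0≤z y≤x)))

  0≤1 : 0# ≤ 1#
  0≤1 with total 0# 1#
  ... | inj₁ 0≤1 = 0≤1
  ... | inj₂ 1≤0 = begin
    0#                ≤⟨ *-nonneg 0≤-1 0≤-1 ⟩
    (- 1#) * (- 1#)   ≈⟨ -1*x≈-x (- 1#) ⟩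
    - (- 1#)          ≈⟨ -‿involutive 1# ⟩
    1#                ∎
    where
    open ≤-Reasoning
    0≤-1 : 0# ≤ (- 1#)
    0≤-1 = begin
      0#        ≈⟨ -‿inverseʳ 1# ⟨
      1# - 1#   ≤⟨ +-monoˡ-≤ (- 1#) 1≤0 ⟩
      0# - 1#   ≈⟨ +-identityˡ (- 1#) ⟩
      - 1#      ∎

  ι-nonneg : ∀ m → 0# ≤ ι m
  ι-nonneg zero    = ≤-refl
  ι-nonneg (suc m) = begin
    0#         ≈⟨ +-identityʳ 0# ⟨
    0# + 0#    ≤⟨ +-mono-≤ 0≤1 (ι-nonneg m) ⟩
    1# + ι m   ∎
    where open ≤-Reasoning

  ι-mono-≤ : ∀ {m n} → m ℕ.≤ n → ι m ≤ ι n
  ι-mono-≤ {n = n} ℕ.z≤n = ι-nonneg n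
  ι-mono-≤ (ℕ.s≤s m≤n)   = +-monoʳ-≤ 1# (ι-mono-≤ m≤n)

  ι-pos : ∀ {m} → 0 ℕ.< m → 0# < ι m
  ι-pos {suc m} _ = ι-nonneg (suc m) , λ 0≈ι[1+m] →
    1≉0 (antisym (≤-trans 1≤ι[1+m] (≤-reflexive (sym 0≈ι[1+m]))) 0≤1)
    where
    1≤ι[1+m] : 1# ≤ ι (suc m)
    1≤ι[1+m] = ≤-trans (≤-reflexive (sym (+-identityʳ 1#))) (+-monoʳ-≤ 1# (ι-nonneg m))

  ι-suc-* : ∀ m x → (ι (suc m) * x) ≈ (x + ι m * x)
  ι-suc-* m x = trans (distribʳ x 1# (ι m)) (+-congʳ (*-identityˡ x))

  ι-+-* : ∀ m n x → (ι (m ℕ.+ n) * x) ≈ (ι m * x + ι n * x)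
  ι-+-* zero    n x = sym (trans (+-congʳ (zeroˡ x)) (+-identityˡ (ι n * x)))
  ι-+-* (suc m) n x = begin
    ι (suc m ℕ.+ n) * x      ≈⟨ ι-suc-* (m ℕ.+ n) x ⟩
    x + ι (m ℕ.+ n) * x      ≈⟨ +-congˡ (ι-+-* m n x) ⟩
    x + (ι m * x + ι n * x)  ≈⟨ +-assoc x (ι m * x) (ι n * x) ⟨
    (x + ι m * x) + ι n * x  ≈⟨ +-congʳ (ι-suc-* m x) ⟨
    ι (suc m) * x + ι n * x  ∎
    where open SetoidReasoning setoid

  ι-*-mono-≤ : ∀ {m n x} → 0# ≤ x → m ℕ.≤ n → (ι m * x) ≤ (ι n * x)
  ι-*-mono-≤ 0≤x m≤n = *-monoʳ-≤ 0≤x (ι-mono-≤ m≤n)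

  stepwise-mono : ∀ (g : ℕ → Carrier) {d} → (∀ j → j ℕ.< d → g j ≤ g (suc j)) →
                  ∀ {t} → t ℕ.≤ d → g t ≤ g d
  stepwise-mono g {zero}  _    ℕ.z≤n = ≤-refl
  stepwise-mono g {suc d} step t≤1+d with ℕₚ.m≤n⇒m<n∨m≡n t≤1+d
  ... | inj₂ refl        = ≤-refl
  ... | inj₁ (ℕ.s≤s t≤d) =
    ≤-trans (stepwise-mono g (λ j j<d → step j (ℕₚ.m<n⇒m<1+n j<d)) t≤d) (step d (ℕₚ.n<1+n d))

  telescope-≤ : ∀ (g : ℕ → Carrier) {c} s → (∀ i → i ℕ.< s → (g (suc i) - g i) ≤ c) →
                (g s - g 0) ≤ (ι s * c)
  telescope-≤ g {c} zero    _    = ≤-reflexive (trans (-‿inverseʳ (g 0)) (sym (zeroˡ c)))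
  telescope-≤ g {c} (suc s) step = begin
    g (suc s) - g 0                  ≈⟨ x-y+[y-z]≈x-z (g (suc s)) (g s) (g 0) ⟨
    (g (suc s) - g s) + (g s - g 0)  ≤⟨ +-mono-≤ (step s (ℕₚ.n<1+n s))
                                          (telescope-≤ g s (λ i i<s → step i (ℕₚ.m<n⇒m<1+n i<s))) ⟩
    c + ι s * c                      ≈⟨ ι-suc-* s c ⟨
    ι (suc s) * c                    ∎
    where open ≤-Reasoning

module Greedy {c ℓ₁ ℓ₂} (F : OrderedField c ℓ₁ ℓ₂) {n : ℕ} (f : Vecℕ n → OrderedField.Carrier F)
  (k : ℕ) (α : OrderedField.Carrier F) (k>0 : 0 ℕ.< k)
  (nonneg : Setup.NonNeg F f k α) (dr : Setup.DRSubmodular F f k α) where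

  open OrderedField F hiding (+-mono-≤)
  open OrderedFieldProperties F
  open import Algebra.Properties.Ring ring using (x[y-z]≈xy-xz)

  ≤αk : ℕ → Set ℓ₂
  ≤αk = Setup.≤αk F f k α

  IsO₁ : Vecℕ n → Vecℕ n → Set ℓ₂
  IsO₁ = Setup.IsO₁ F f k α

  Cond : Vecℕ n → Fin n → ℕ → Set ℓ₂
  Cond = Setup.Cond F f k α

  IsD : Vecℕ n → Fin n → ℕ → Set ℓ₂
  IsD = Setup.IsD F f k α

  gain : Vecℕ n → Fin n → ℕ → Carrier
  gain = Setup.gain F f k α

  Step : Fin n → Vecℕ n × Vecℕ n → Vecℕ n × Vecℕ n → Set ℓ₂
  Step = Setup.Step F f k α

  Run : List (Fin n) → Vecℕ n × Vecℕ n → Vecℕ n × Vecℕ n → Set ℓ₂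
  Run = Setup.Run F f k α

  K : Carrier
  K = ι k

  0<K : 0# < K
  0<K = ι-pos k>0

  0≤K : 0# ≤ K
  0≤K = proj₁ 0<K

  K*[x-x]≈0 : ∀ x → (K * (x - x)) ≈ 0#
  K*[x-x]≈0 x = trans (*-congˡ (-‿inverseʳ x)) (zeroʳ K)

  gain-zero : ∀ p e → gain p e 0 ≈ 0#
  gain-zero p e = trans (+-congʳ (reflexive (cong f (bump-0 p e)))) (-‿inverseʳ (f p))

  gain-+ : ∀ p e a b → gain p e (a ℕ.+ b) ≈ (gain p e a + gain (bump p e a) e b)
  gain-+ p e a b = begin
    f (bump p e (a ℕ.+ b)) - f p        ≡⟨ cong (λ v → f v - f p) (≡.sym (bump-bump p e a b)) ⟩
    f (bump (bump p e a) e b) - f p     ≈⟨ x-y+[y-z]≈x-z _ _ _ ⟨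
    gain (bump p e a) e b + gain p e a  ≈⟨ +-comm _ _ ⟩
    gain p e a + gain (bump p e a) e b  ∎
    where open SetoidReasoning setoid

  gain-antitone : ∀ {p w} → p ≤ᵥ w → ∀ e t → gain w e t ≤ gain p e t
  gain-antitone {p} {w} p≤w e zero    = ≤-reflexive (trans (gain-zero w e) (sym (gain-zero p e)))
  gain-antitone {p} {w} p≤w e (suc t) = begin
    gain w e (suc t)                    ≈⟨ gain-+ w e 1 t ⟩
    gain w e 1 + gain (bump w e 1) e t  ≤⟨ +-mono-≤ (dr p w p≤w e)
                                             (gain-antitone (bump-mono p w e p≤w ℕₚ.≤-refl) e t) ⟩
    gain p e 1 + gain (bump p e 1) e t  ≈⟨ gain-+ p e 1 t ⟨
    gain p e (suc t)                    ∎
    where open ≤-Reasoning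

  ray-step : ∀ p e j → (f (bump p e (suc j)) - f (bump p e j)) ≈ gain (bump p e j) e 1
  ray-step p e j = +-congʳ (reflexive (cong f (≡.sym (bump-suc p e j))))

  IsD-maximal : ∀ {p e d j} → IsD p e d → d ℕ.< j → ≤αk j → ¬ Cond p e j
  IsD-maximal (inj₁ (refl , none))       = none _
  IsD-maximal (inj₂ (_ , _ , _ , above)) = above _

  IsD-marginal-small : ∀ {p e d j} → IsD p e d → d ℕ.≤ j → ≤αk (suc j) → (K * gain (bump p e j) e 1) ≤ f p
  IsD-marginal-small isD d≤j j+1≤αk = ≰⇒≥ (IsD-maximal isD (ℕ.s≤s d≤j) j+1≤αk)

  IsD-marginal-nonneg : ∀ {p e d j} → IsD p e d → j ℕ.< d → 0# ≤ gain (bump p e j) e 1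
  IsD-marginal-nonneg (inj₁ (refl , _)) ()
  IsD-marginal-nonneg {p} {e} {suc d} {j} (inj₂ (_ , _ , cond , _)) (ℕ.s≤s j≤d) = begin
    0#                     ≤⟨ *-cancelˡ-≤ 0<K K*0≤K*marginal ⟩
    gain (bump p e d) e 1  ≤⟨ dr (bump p e j) (bump p e d) (bump-monoʳ p e j≤d) e ⟩
    gain (bump p e j) e 1  ∎
    where
    open ≤-Reasoning
    K*0≤K*marginal : (K * 0#) ≤ (K * gain (bump p e d) e 1)
    K*0≤K*marginal = ≤-trans (≤-reflexive (zeroʳ K)) (≤-trans (nonneg p) cond)

  IsD-ray-mono : ∀ {p e d t} → IsD p e d → t ℕ.≤ d → f (bump p e t) ≤ f (bump p e d)
  IsD-ray-mono {p} {e} {d} isD = stepwise-mono (λ j → f (bump p e j)) ray-increases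
    where
    ray-increases : ∀ j → j ℕ.< d → f (bump p e j) ≤ f (bump p e (suc j))
    ray-increases j j<d =
      0≤y-x⇒x≤y (≤-trans (IsD-marginal-nonneg isD j<d) (≤-reflexive (sym (ray-step p e j))))

  IsD-improves : ∀ {p e d} → IsD p e d → f p ≤ f (bump p e d)
  IsD-improves {p} {e} isD =
    ≤-trans (≤-reflexive (reflexive (cong f (≡.sym (bump-0 p e))))) (IsD-ray-mono isD ℕ.z≤n)

  IsD-gain-≤ : ∀ {p e d} → IsD p e d → ∀ t → gain p e t ≤ gain p e (d ℕ.+ (t ℕ.∸ d))
  IsD-gain-≤ {p} {e} {d} isD t = +-monoˡ-≤ (- f p) (ray-bound (ℕₚ.≤-total t d))
    where
    ray-at : ∀ {i j} → i ≡ j → f (bump p e i) ≤ f (bump p e j)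
    ray-at i≡j = ≤-reflexive (reflexive (cong (λ i → f (bump p e i)) i≡j))
    ray-bound : (t ℕ.≤ d) ⊎ (d ℕ.≤ t) → f (bump p e t) ≤ f (bump p e (d ℕ.+ (t ℕ.∸ d)))
    ray-bound (inj₁ t≤d) = ≤-trans (IsD-ray-mono isD t≤d)
      (ray-at (≡.sym (≡.trans (cong (d ℕ.+_) (ℕₚ.m≤n⇒m∸n≡0 t≤d)) (ℕₚ.+-identityʳ d))))
    ray-bound (inj₂ d≤t) = ray-at (≡.sym (ℕₚ.m+[n∸m]≡n d≤t))

  Small : ℕ → Set ℓ₂
  Small o = ∀ j → j ℕ.< o → ≤αk (suc j)

  gain-past-IsD : ∀ {p e d o s M} → IsD p e d → f p ≤ M → 0# ≤ M → Small o → s ℕ.≤ o ℕ.∸ d →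
                  (K * (f (bump p e (d ℕ.+ s)) - f (bump p e d))) ≤ (ι o * M)
  gain-past-IsD {p} {e} {d} {o} {s} {M} isD fp≤M 0≤M small s≤o∸d = begin
    K * (f (bump p e (d ℕ.+ s)) - f (bump p e d))
      ≡⟨ cong (λ i → K * (f (bump p e (d ℕ.+ s)) - f (bump p e i))) (≡.sym (ℕₚ.+-identityʳ d)) ⟩
    K * (f (bump p e (d ℕ.+ s)) - f (bump p e (d ℕ.+ 0)))
      ≈⟨ x[y-z]≈xy-xz K _ _ ⟩
    g s - g 0
      ≤⟨ telescope-≤ g s increment ⟩
    ι s * M
      ≤⟨ ι-*-mono-≤ 0≤M (ℕₚ.≤-trans s≤o∸d (ℕₚ.m∸n≤m o d)) ⟩
    ι o * M
      ∎
    where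
    open ≤-Reasoning
    g : ℕ → Carrier
    g i = K * f (bump p e (d ℕ.+ i))
    increment : ∀ i → i ℕ.< s → (g (suc i) - g i) ≤ M
    increment i i<s = begin
      g (suc i) - g i
        ≈⟨ x[y-z]≈xy-xz K _ _ ⟨
      K * (f (bump p e (d ℕ.+ suc i)) - f (bump p e (d ℕ.+ i)))
        ≡⟨ cong (λ j → K * (f (bump p e j) - f (bump p e (d ℕ.+ i)))) (ℕₚ.+-suc d i) ⟩
      K * (f (bump p e (suc (d ℕ.+ i))) - f (bump p e (d ℕ.+ i)))
        ≈⟨ *-congˡ (ray-step p e (d ℕ.+ i)) ⟩
      K * gain (bump p e (d ℕ.+ i)) e 1
        ≤⟨ IsD-marginal-small isD (ℕₚ.m≤m+n d i) (small (d ℕ.+ i) (m<n∸o⇒o+m<n (ℕₚ.<-≤-trans i<s s≤o∸d))) ⟩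
      f p
        ≤⟨ fp≤M ⟩
      M
        ∎

  -- The algorithm seen from one of its two vectors, p; the other one is q. Both (x , y) and
  -- (y , x) are instances, so the analysis below is done once for both vectors.
  data OneSidedStep (e : Fin n) : Vecℕ n × Vecℕ n → Vecℕ n × Vecℕ n → Set ℓ₂ where
    grow  : ∀ {p q d} → IsD p e d → OneSidedStep e (p , q) (bump p e d , q)
    defer : ∀ {p q q′ d} → IsD p e d → gain p e d ≤ (f q′ - f q) → OneSidedStep e (p , q) (p , q′)

  data OneSidedRun : List (Fin n) → Vecℕ n × Vecℕ n → Vecℕ n × Vecℕ n → Set ℓ₂ where
    []  : ∀ {s} → OneSidedRun [] s s
    _∷_ : ∀ {e es s r t} → OneSidedStep e s r → OneSidedRun es r t → OneSidedRun (e ∷ es) s t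

  Step⇒OneSidedStepˡ : ∀ {e x y x′ y′} → Step e (x , y) (x′ , y′) → OneSidedStep e (x , y) (x′ , y′)
  Step⇒OneSidedStepˡ (_ , _ , x-d , _ , inj₁ (_ , refl , refl))      = grow x-d
  Step⇒OneSidedStepˡ (_ , _ , x-d , _ , inj₂ (y-wins , refl , refl)) = defer x-d (≰⇒≥ y-wins)

  Step⇒OneSidedStepʳ : ∀ {e x y x′ y′} → Step e (x , y) (x′ , y′) → OneSidedStep e (y , x) (y′ , x′)
  Step⇒OneSidedStepʳ (_ , _ , _ , y-d , inj₁ (x-wins , refl , refl)) = defer y-d x-wins
  Step⇒OneSidedStepʳ (_ , _ , _ , y-d , inj₂ (_ , refl , refl))      = grow y-d

  Run⇒OneSidedRunˡ : ∀ {es x y x′ y′} → Run es (x , y) (x′ , y′) → OneSidedRun es (x , y) (x′ , y′)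
  Run⇒OneSidedRunˡ {[]}    (lift refl)      = []
  Run⇒OneSidedRunˡ {_ ∷ _} (_ , step , run) = Step⇒OneSidedStepˡ step ∷ Run⇒OneSidedRunˡ run

  Run⇒OneSidedRunʳ : ∀ {es x y x′ y′} → Run es (x , y) (x′ , y′) → OneSidedRun es (y , x) (y′ , x′)
  Run⇒OneSidedRunʳ {[]}    (lift refl)      = []
  Run⇒OneSidedRunʳ {_ ∷ _} (_ , step , run) = Step⇒OneSidedStepʳ step ∷ Run⇒OneSidedRunʳ run

  OneSidedStep-≤ᵥ : ∀ {e p q p′ q′} → OneSidedStep e (p , q) (p′ , q′) → p ≤ᵥ p′
  OneSidedStep-≤ᵥ {e} (grow {p} {d = d} _) = ≤ᵥ-bump p e d
  OneSidedStep-≤ᵥ (defer _ _)              = λ _ → ℕₚ.≤-refl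

  OneSidedStep-improves : ∀ {e p q p′ q′} → OneSidedStep e (p , q) (p′ , q′) → f p ≤ f p′
  OneSidedStep-improves (grow isD)  = IsD-improves isD
  OneSidedStep-improves (defer _ _) = ≤-refl

  OneSidedRun-≤ᵥ : ∀ {es p q p′ q′} → OneSidedRun es (p , q) (p′ , q′) → p ≤ᵥ p′
  OneSidedRun-≤ᵥ []                                         = λ _ → ℕₚ.≤-refl
  OneSidedRun-≤ᵥ {p = p} {p′ = p′} (_∷_ {r = r , _} step run) =
    ≤ᵥ-trans p r p′ (OneSidedStep-≤ᵥ step) (OneSidedRun-≤ᵥ run)

  OneSidedRun-improves : ∀ {es p q p′ q′} → OneSidedRun es (p , q) (p′ , q′) → f p ≤ f p′
  OneSidedRun-improves []           = ≤-refl
  OneSidedRun-improves (step ∷ run) = ≤-trans (OneSidedStep-improves step) (OneSidedRun-improves run)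

  OneSidedRun-lookup-∉ : ∀ {e es p q p′ q′} → All (e ≢_) es → OneSidedRun es (p , q) (p′ , q′) →
                         lookup p′ e ≡ lookup p e
  OneSidedRun-lookup-∉ []            []                         = ≡.refl
  OneSidedRun-lookup-∉ (e≢e′ ∷ e∉es) (grow {p} {d = d} _ ∷ run) =
    ≡.trans (OneSidedRun-lookup-∉ e∉es run) (lookup-bump-≢ p e≢e′ d)
  OneSidedRun-lookup-∉ (_ ∷ e∉es)    (defer _ _ ∷ run)          = OneSidedRun-lookup-∉ e∉es run

  OneSidedStep-loss : ∀ {e p q p′ q′ o M} → Small o → OneSidedStep e (p , q) (p′ , q′) →
                      f p ≤ M → 0# ≤ M →
                      (K * gain p′ e (o ℕ.∸ lookup p′ e)) ≤ (ι o * M + K * (f q′ - f q))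
  OneSidedStep-loss {e} {o = o} {M} small (grow {p} {q} {d} isD) fp≤M 0≤M = begin
    K * gain (bump p e d) e t
      ≡⟨ cong (λ v → K * (f v - f (bump p e d))) (bump-bump p e d t) ⟩
    K * (f (bump p e (d ℕ.+ t)) - f (bump p e d))
      ≤⟨ gain-past-IsD isD fp≤M 0≤M small t≤o∸d ⟩
    ι o * M
      ≈⟨ +-identityʳ (ι o * M) ⟨
    ι o * M + 0#
      ≈⟨ +-congˡ (K*[x-x]≈0 (f q)) ⟨
    ι o * M + K * (f q - f q)
      ∎
    where
    open ≤-Reasoning
    t = o ℕ.∸ lookup (bump p e d) e
    t≤o∸d : t ℕ.≤ o ℕ.∸ d
    t≤o∸d = ≡.subst (λ c → o ℕ.∸ c ℕ.≤ o ℕ.∸ d) (≡.sym (lookup-bump p e d))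
              (ℕₚ.∸-monoʳ-≤ o (ℕₚ.m≤n+m d (lookup p e)))
  OneSidedStep-loss {e} {o = o} {M} small (defer {p} {q} {q′} {d} isD gain≤) fp≤M 0≤M = begin
    K * gain p e t
      ≤⟨ *-monoˡ-≤ 0≤K (IsD-gain-≤ isD t) ⟩
    K * gain p e (d ℕ.+ s)
      ≈⟨ *-congˡ (x-y+[y-z]≈x-z _ _ _) ⟨
    K * ((f (bump p e (d ℕ.+ s)) - f (bump p e d)) + gain p e d)
      ≈⟨ distribˡ K _ _ ⟩
    K * (f (bump p e (d ℕ.+ s)) - f (bump p e d)) + K * gain p e d
      ≤⟨ +-mono-≤ (gain-past-IsD isD fp≤M 0≤M small s≤o∸d) (*-monoˡ-≤ 0≤K gain≤) ⟩
    ι o * M + K * (f q′ - f q)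
      ∎
    where
    open ≤-Reasoning
    t = o ℕ.∸ lookup p e
    s = t ℕ.∸ d
    s≤o∸d : s ℕ.≤ o ℕ.∸ d
    s≤o∸d = ℕₚ.∸-monoˡ-≤ d (ℕₚ.m∸n≤m o (lookup p e))

  module _ (o₁ : Vecℕ n) (o₁-small : ∀ e → Small (lookup o₁ e)) where

    loss-bound : ∀ {es p q p′ q′} → Unique es → OneSidedRun es (p , q) (p′ , q′) →
                 (K * (f (p′ ∨ (o₁ ↾ es)) - f p′)) ≤ (ι (sum (o₁ ↾ es)) * f p′ + K * (f q′ - f q))
    loss-bound {p = p} {q} [] [] = begin
      K * (f (p ∨ (o₁ ↾ [])) - f p)
        ≡⟨ cong (λ v → K * (f v - f p)) (zipWith-identityʳ ℕₚ.⊔-identityʳ p) ⟩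
      K * (f p - f p)
        ≈⟨ K*[x-x]≈0 (f p) ⟩
      0#
        ≈⟨ +-identityʳ 0# ⟨
      0# + 0#
        ≤⟨ +-mono-≤ (*-nonneg (ι-nonneg (sum (o₁ ↾ []))) (nonneg p)) (≤-reflexive (sym (K*[x-x]≈0 (f q)))) ⟩
      ι (sum (o₁ ↾ [])) * f p + K * (f q - f q)
        ∎
      where open ≤-Reasoning
    loss-bound {p = p} {q} {pf} {qf} (_∷_ {e} {es} e∉es unique) (_∷_ {r = p₁ , q₁} step run) = begin
      K * (f (pf ∨ (o₁ ↾ (e ∷ es))) - M)
        ≡⟨ cong (λ v → K * (f v - M)) pf∨o₁↾e∷es ⟩
      K * (f (bump w e t) - M)
        ≈⟨ *-congˡ (x-y+[y-z]≈x-z _ (f w) _) ⟨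
      K * (gain w e t + (f w - M))
        ≈⟨ distribˡ K _ _ ⟩
      K * gain w e t + K * (f w - M)
        ≤⟨ +-mono-≤ (*-monoˡ-≤ 0≤K (gain-antitone p₁≤w e t)) (loss-bound unique run) ⟩
      K * gain p₁ e t + (ι S * M + K * (f qf - f q₁))
        ≤⟨ +-monoˡ-≤ _ (OneSidedStep-loss (o₁-small e) step fp≤M (nonneg pf)) ⟩
      (ι o * M + K * (f q₁ - f q)) + (ι S * M + K * (f qf - f q₁))
        ≈⟨ interchange _ _ _ _ ⟩
      (ι o * M + ι S * M) + (K * (f q₁ - f q) + K * (f qf - f q₁))
        ≈⟨ +-cong (+-comm _ _) K-telescope ⟩
      (ι S * M + ι o * M) + K * (f qf - f q)
        ≈⟨ +-congʳ (ι-+-* S o M) ⟨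
      ι (S ℕ.+ o) * M + K * (f qf - f q)
        ≡⟨ cong (λ m → ι m * M + K * (f qf - f q)) (≡.sym (sum-bump (o₁ ↾ es) e o)) ⟩
      ι (sum (o₁ ↾ (e ∷ es))) * M + K * (f qf - f q)
        ∎
      where
      open ≤-Reasoning
      o = lookup o₁ e
      w = pf ∨ (o₁ ↾ es)
      t = o ℕ.∸ lookup p₁ e
      S = sum (o₁ ↾ es)
      M = f pf
      pf∨o₁↾e∷es : pf ∨ (o₁ ↾ (e ∷ es)) ≡ bump w e t
      pf∨o₁↾e∷es = ≡.trans (∨-bump pf (o₁ ↾ es) e o (lookup-↾-∉ o₁ es e∉es))
                            (cong (λ c → bump w e (o ℕ.∸ c)) (OneSidedRun-lookup-∉ e∉es run))
      p₁≤w : p₁ ≤ᵥ w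
      p₁≤w = ≤ᵥ-trans p₁ pf w (OneSidedRun-≤ᵥ run) (≤ᵥ-∨ˡ pf (o₁ ↾ es))
      fp≤M : f p ≤ M
      fp≤M = ≤-trans (OneSidedStep-improves step) (OneSidedRun-improves run)
      K-telescope : (K * (f q₁ - f q) + K * (f qf - f q₁)) ≈ (K * (f qf - f q))
      K-telescope = trans (sym (distribˡ K _ _)) (*-congˡ (trans (+-comm _ _) (x-y+[y-z]≈x-z _ _ _)))

    one-side-bound : sum o₁ ℕ.≤ k → ∀ {x y} →
                     OneSidedRun (allFin n) (replicate n 0 , replicate n 0) (x , y) →
                     f (o₁ ∨ x) ≤ ((f x + f y) + f x)
    one-side-bound sum≤k {x} {y} run = x-y≤z⇒x≤z+y (*-cancelˡ-≤ 0<K (begin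
      K * (f (o₁ ∨ x) - f x)
        ≡⟨ cong (λ v → K * (f v - f x)) o₁∨x≡x∨o₁↾E ⟩
      K * (f (x ∨ (o₁ ↾ allFin n)) - f x)
        ≤⟨ loss-bound (allFin⁺ n) run ⟩
      ι (sum (o₁ ↾ allFin n)) * f x + K * (f y - f 0⃗)
        ≡⟨ cong (λ v → ι (sum v) * f x + K * (f y - f 0⃗)) (↾-allFin o₁) ⟩
      ι (sum o₁) * f x + K * (f y - f 0⃗)
        ≤⟨ +-mono-≤ (ι-*-mono-≤ (nonneg x) sum≤k) (*-monoˡ-≤ 0≤K (x-y≤x (nonneg 0⃗))) ⟩
      K * f x + K * f y
        ≈⟨ distribˡ K (f x) (f y) ⟨
      K * (f x + f y)
        ∎))
      where
      open ≤-Reasoning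
      0⃗ : Vecℕ n
      0⃗ = replicate n 0
      o₁∨x≡x∨o₁↾E : o₁ ∨ x ≡ x ∨ (o₁ ↾ allFin n)
      o₁∨x≡x∨o₁↾E = ≡.trans (zipWith-comm ℕₚ.⊔-comm o₁ x) (cong (x ∨_) (≡.sym (↾-allFin o₁)))

    pair-bound : sum o₁ ℕ.≤ k → ∀ {x y} → Run (allFin n) (replicate n 0 , replicate n 0) (x , y) →
                 (f (o₁ ∨ x) + f (o₁ ∨ y)) ≤ (ι 4 * (f x + f y))
    pair-bound sum≤k {x} {y} run = begin
      f (o₁ ∨ x) + f (o₁ ∨ y)  ≤⟨ +-mono-≤ (one-side-bound sum≤k (Run⇒OneSidedRunˡ run))
                                           (one-side-bound sum≤k (Run⇒OneSidedRunʳ run)) ⟩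
      (S + f x) + (S′ + f y)   ≤⟨ +-mono-≤ (+-monoʳ-≤ S (x≤x+y (nonneg y))) (+-monoʳ-≤ S′ (x≤x+y (nonneg x))) ⟩
      (S + S) + (S′ + S′)      ≈⟨ +-congˡ (+-cong (+-comm (f y) (f x)) (+-comm (f y) (f x))) ⟩
      (S + S) + (S + S)        ≈⟨ +-cong 2S≈S+S 2S≈S+S ⟨
      ι 2 * S + ι 2 * S        ≈⟨ ι-+-* 2 2 S ⟨
      ι 4 * S                  ∎
      where
      open ≤-Reasoning
      S S′ : Carrier
      S  = f x + f y
      S′ = f y + f x
      2S≈S+S : (ι 2 * S) ≈ (S + S)
      2S≈S+S = trans (ι-suc-* 1 S) (+-congˡ (trans (ι-suc-* 0 S) (trans (+-congˡ (zeroˡ S)) (+-identityʳ S))))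

  IsO₁⇒small : (o o₁ : Vecℕ n) → IsO₁ o o₁ → ∀ e → Small (lookup o₁ e)
  IsO₁⇒small o o₁ o₁-def e j j<o₁[e] with o₁-def e
  ... | inj₁ (o[e]≤αk , o₁[e]≡o[e]) = ≤-trans (ι-mono-≤ (≡.subst (suc j ℕ.≤_) o₁[e]≡o[e] j<o₁[e])) o[e]≤αk
  ... | inj₂ (_ , o₁[e]≡0)          = contradiction (≡.subst (j ℕ.<_) o₁[e]≡0 j<o₁[e]) ℕₚ.n≮0

  IsO₁⇒≤ᵥ : (o o₁ : Vecℕ n) → IsO₁ o o₁ → o₁ ≤ᵥ o
  IsO₁⇒≤ᵥ o o₁ o₁-def e with o₁-def e
  ... | inj₁ (_ , o₁[e]≡o[e]) = ℕₚ.≤-reflexive o₁[e]≡o[e]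
  ... | inj₂ (_ , o₁[e]≡0)    = ≡.subst (ℕ._≤ _) (≡.sym o₁[e]≡0) ℕ.z≤n

lemma3 : ∀ {c ℓ₁ ℓ₂ : Level} (F : OrderedField c ℓ₁ ℓ₂) → let open OrderedField F in let open Setup F in
    (n : ℕ) (f : Vecℕ n → Carrier) (k : ℕ) (α : Carrier) →
    0 ℕ.< k → 0# < α → α < 1# →
    NonNeg f k α → DRSubmodular f k α →
    (o o₁ : Vecℕ n) → Optimal f k α o → IsO₁ f k α o o₁ →
    (x y : Vecℕ n) → Run f k α (allFin n) (replicate n 0 , replicate n 0) (x , y) →
    (f (o₁ ∨ x) + f (o₁ ∨ y)) ≤ (ι 4 * (f x + f y))
lemma3 F n f k α k>0 _ _ nonneg dr o o₁ (o-feasible , _) o₁-def x y run =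
  pair-bound o₁ (IsO₁⇒small o o₁ o₁-def) sum[o₁]≤k run
  where
  open Greedy F f k α k>0 nonneg dr using (pair-bound; IsO₁⇒small; IsO₁⇒≤ᵥ)
  sum[o₁]≤k : sum o₁ ℕ.≤ k
  sum[o₁]≤k = ℕₚ.≤-trans (sum-mono-≤ᵥ o₁ o (IsO₁⇒≤ᵥ o o₁ o₁-def)) (proj₁ o-feasible)
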